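{- Let $P$ be a pebbling distribution on the grid $\Lambda_{m,n}$. Any region of reachability under $P$ that contains exactly $k$ vertices which are $2$-reachable contains at most $3k+2$ vertices.
   Context: The grid $\Lambda_{m,n}$ is the graph whose vertices are the $nm$ cells of an $m\times n$ array, two cells being adjacent iff they share a side. A pebbling distribution is a function $P:V\to\mathbb{Z}_{\ge0}$. A pebbling move removes $2$ pebbles from a vertex and adds $1$ pebble to a neighbouring vertex. A vertex is $2$-reachable if some sequence of pebbling moves from $P$ yields at least $2$ pebbles on it. A region of reachability under $P$ is the vertex set of a maximal connected subgraph all of whose vertices are $2$-reachable, together with all neighbours of those vertices. -}

module Defs where

open import Data.Nat using (ℕ; suc; _+_; _≤_)
open import Data.Fin using (Fin; toℕ)
open import Data.Product using (Σ; ∃; _×_; _,_)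
open import Data.Sum using (_⊎_)
open import Data.List using (List; length)
open import Data.List.Membership.Propositional using (_∈_)
open import Data.List.Relation.Unary.Unique.Propositional using (Unique)
open import Relation.Binary.PropositionalEquality using (_≡_; _≢_)
open import Relation.Binary.Construct.Closure.ReflexiveTransitive using (Star)
open import Relation.Nullary using (¬_)
open import Function.Bundles using (_⇔_)

Vertex : ℕ → ℕ → Set
Vertex m n = Fin m × Fin n

Next : ∀ {k} → Fin k → Fin k → Set
Next a b = suc (toℕ a) ≡ toℕ b ⊎ suc (toℕ b) ≡ toℕ a

Adj : ∀ {m n} → Vertex m n → Vertex m n → Set
Adj (i , j) (i' , j') = (i ≡ i' × Next j j') ⊎ (j ≡ j' × Next i i')

Distribution : ℕ → ℕ → Set
Distribution m n = Vertex m n → ℕ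

Move : ∀ {m n} → Distribution m n → Distribution m n → Set
Move {m} {n} P Q =
  Σ (Vertex m n) λ u → Σ (Vertex m n) λ v →
    Adj u v × (Q u + 2 ≡ P u) × (Q v ≡ P v + 1)
    × (∀ w → w ≢ u → w ≢ v → Q w ≡ P w)

Reaches : ∀ {m n} → Distribution m n → Distribution m n → Set
Reaches = Star Move

TwoReachable : ∀ {m n} → Distribution m n → Vertex m n → Set
TwoReachable P v = ∃ λ Q → Reaches P Q × 2 ≤ Q v

data PathIn {m n} (S : Vertex m n → Set) : Vertex m n → Vertex m n → Set where
  here : ∀ {u} → S u → PathIn S u u
  step : ∀ {u w v} → S u → Adj u w → PathIn S w v → PathIn S u v

Connected : ∀ {m n} → (Vertex m n → Set) → Set
Connected S = (∃ λ v → S v) × (∀ u v → S u → S v → PathIn S u v)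

ReachableConnected : ∀ {m n} → Distribution m n → (Vertex m n → Set) → Set
ReachableConnected P S = Connected S × (∀ v → S v → TwoReachable P v)

IsReachComponent : ∀ {m n} → Distribution m n → (Vertex m n → Set) → Set₁
IsReachComponent P S =
  ReachableConnected P S ×
  (∀ S' → (∀ v → S v → S' v) → ReachableConnected P S' → ∀ v → S' v → S v)

Region : ∀ {m n} → (Vertex m n → Set) → Vertex m n → Set
Region S v = S v ⊎ (∃ λ u → S u × Adj u v)

Enumerates : ∀ {m n} → List (Vertex m n) → (Vertex m n → Set) → Set
Enumerates xs A = Unique xs × (∀ v → (v ∈ xs) ⇔ A v)

-- The 2-reachable vertices of a region form a connected set T (each lies in S
-- or next to S, and S is connected), and the region is contained in the closed
-- neighbourhood of T.  Adding the vertices of a connected set one at a time,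
-- each new vertex adjacent to an earlier one, the first contributes at most
-- 1 + 4 cells to the closed neighbourhood and every later one at most 3, since
-- the grid has maximum degree 4 and one neighbour is already present.  Hence
-- the region has at most 5 + 3 (k - 1) = 3 k + 2 vertices.
module Submission where

open import Defs
open import Data.Nat using (ℕ; zero; suc; _+_; _*_; _≤_; _<_; _<?_; z≤n; s≤s)
open import Data.Nat.Properties
  using (suc-injective; ≤-trans; ≤-pred; +-mono-≤; +-monoˡ-≤; *-monoʳ-≤; *-suc; +-assoc; +-identityʳ; +-suc; <⇒≱; m≤n+m; module ≤-Reasoning)
open import Data.Fin as Fin using (Fin; toℕ; fromℕ<; inject₁)
open import Data.Fin.Properties using (toℕ-injective; toℕ-fromℕ<; toℕ-inject₁; toℕ<n)
open import Data.Product using (∃; _×_; _,_; proj₁)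
open import Data.Product.Properties using (≡-dec)
open import Data.Sum using (_⊎_; inj₁; inj₂)
import Data.Sum as Sum
open import Data.List using (List; []; _∷_; [_]; _++_; map; filter; length)
open import Data.List.Properties using (length-++; length-map; filter-notAll)
open import Data.List.Membership.Propositional using (_∈_; _∉_; find)
open import Data.List.Membership.Propositional.Properties using (∈-map⁺; ∈-++⁺ˡ; ∈-++⁺ʳ; ∈-filter⁺)
open import Data.List.Relation.Binary.Subset.Propositional using (_⊆_)
open import Data.List.Relation.Binary.Subset.Propositional.Properties using (∈-∷⁺ʳ)
open import Data.List.Relation.Unary.Any as Any using (here; there)
open import Data.List.Relation.Unary.All as All using (all?)
open import Data.List.Relation.Unary.All.Properties using (¬All⇒Any¬)
open import Data.List.Relation.Unary.Unique.Propositional using (Unique)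
open import Data.List.Relation.Unary.AllPairs using ([]; _∷_)
open import Relation.Binary.PropositionalEquality using (_≡_; _≢_; refl; sym; trans; cong; subst)
open import Relation.Binary using (DecidableEquality)
open import Relation.Nullary using (yes; no; ¬?)
open import Data.Empty using (⊥-elim)
open import Function using (_∘_)
open import Function.Bundles using (Equivalence)

nextIndex : ∀ {k} → Fin k → List (Fin k)
nextIndex {k} a with suc (toℕ a) <? k
... | yes a+1<k = [ fromℕ< a+1<k ]
... | no _      = []

prevIndex : ∀ {k} → Fin k → List (Fin k)
prevIndex Fin.zero    = []
prevIndex (Fin.suc a) = [ inject₁ a ]

adjacentIndices : ∀ {k} → Fin k → List (Fin k)
adjacentIndices a = nextIndex a ++ prevIndex a

length-nextIndex : ∀ {k} (a : Fin k) → length (nextIndex a) ≤ 1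
length-nextIndex {k} a with suc (toℕ a) <? k
... | yes _ = s≤s z≤n
... | no _  = z≤n

length-prevIndex : ∀ {k} (a : Fin k) → length (prevIndex a) ≤ 1
length-prevIndex Fin.zero    = z≤n
length-prevIndex (Fin.suc a) = s≤s z≤n

length-adjacentIndices : ∀ {k} (a : Fin k) → length (adjacentIndices a) ≤ 2
length-adjacentIndices a
  rewrite length-++ (nextIndex a) {prevIndex a} = +-mono-≤ (length-nextIndex a) (length-prevIndex a)

∈-nextIndex : ∀ {k} {a b : Fin k} → suc (toℕ a) ≡ toℕ b → b ∈ nextIndex a
∈-nextIndex {k} {a} {b} a+1≡b with suc (toℕ a) <? k
... | yes a+1<k = here (toℕ-injective (trans (sym a+1≡b) (sym (toℕ-fromℕ< a+1<k))))
... | no a+1≮k  = ⊥-elim (a+1≮k (subst (_< k) (sym a+1≡b) (toℕ<n b)))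

Next⇒∈adjacentIndices : ∀ {k} {a b : Fin k} → Next a b → b ∈ adjacentIndices a
Next⇒∈adjacentIndices (inj₁ a+1≡b) = ∈-++⁺ˡ (∈-nextIndex a+1≡b)
Next⇒∈adjacentIndices {a = Fin.zero}  (inj₂ ())
Next⇒∈adjacentIndices {a = Fin.suc a} {b} (inj₂ b+1≡a+1) =
  ∈-++⁺ʳ (nextIndex (Fin.suc a))
    (here (toℕ-injective (trans (suc-injective b+1≡a+1) (sym (toℕ-inject₁ a)))))

neighbours : ∀ {m n} → Vertex m n → List (Vertex m n)
neighbours (i , j) = map (i ,_) (adjacentIndices j) ++ map (_, j) (adjacentIndices i)

length-neighbours : ∀ {m n} (v : Vertex m n) → length (neighbours v) ≤ 4
length-neighbours (i , j)
  rewrite length-++ (map (i ,_) (adjacentIndices j)) {map (_, j) (adjacentIndices i)}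
        | length-map (i ,_) (adjacentIndices j)
        | length-map (_, j) (adjacentIndices i)
  = +-mono-≤ (length-adjacentIndices j) (length-adjacentIndices i)

Adj⇒∈neighbours : ∀ {m n} {u w : Vertex m n} → Adj u w → w ∈ neighbours u
Adj⇒∈neighbours {u = i , j} (inj₁ (refl , next)) =
  ∈-++⁺ˡ (∈-map⁺ (i ,_) (Next⇒∈adjacentIndices next))
Adj⇒∈neighbours {u = i , j} (inj₂ (refl , next)) =
  ∈-++⁺ʳ (map (i ,_) (adjacentIndices j)) (∈-map⁺ (_, j) (Next⇒∈adjacentIndices next))

Adj-sym : ∀ {m n} {u w : Vertex m n} → Adj u w → Adj w u
Adj-sym (inj₁ (i≡i' , next)) = inj₁ (sym i≡i' , Sum.swap next)
Adj-sym (inj₂ (j≡j' , next)) = inj₂ (sym j≡j' , Sum.swap next)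

_≟V_ : ∀ {m n} → DecidableEquality (Vertex m n)
_≟V_ = ≡-dec Fin._≟_ Fin._≟_

module _ {m n : ℕ} where

  private
    V : Set
    V = Vertex m n

  open import Data.List.Membership.DecPropositional (_≟V_ {m} {n}) using (_∈?_)

  without : V → List V → List V
  without x = filter (λ y → ¬? (y ≟V x))

  length-without : ∀ {x} {xs : List V} → x ∈ xs → length (without x xs) < length xs
  length-without {x} {xs} x∈xs =
    filter-notAll (λ y → ¬? (y ≟V x)) xs (Any.map (λ y≡x y≢x → y≢x (sym y≡x)) x∈xs)

  ∈-without : ∀ {x y} {xs : List V} → y ∈ xs → y ≢ x → y ∈ without x xs
  ∈-without {x} = ∈-filter⁺ (λ y → ¬? (y ≟V x))

  Unique-∷⁺ : ∀ {x} {xs : List V} → x ∉ xs → Unique xs → Unique (x ∷ xs)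
  Unique-∷⁺ {xs = xs} x∉xs unique = All.tabulate (λ y∈xs x≡y → x∉xs (subst (_∈ xs) (sym x≡y) y∈xs)) ∷ unique

  length-mono-⊆ : ∀ {xs ys : List V} → Unique xs → xs ⊆ ys → length xs ≤ length ys
  length-mono-⊆ [] _ = z≤n
  length-mono-⊆ {x ∷ xs} {ys} (x∉xs ∷ unique) x∷xs⊆ys =
    ≤-trans (s≤s (length-mono-⊆ unique xs⊆ys-x)) (length-without (x∷xs⊆ys (here refl)))
    where
    xs⊆ys-x : xs ⊆ without x ys
    xs⊆ys-x z∈xs = ∈-without (x∷xs⊆ys (there z∈xs)) (λ z≡x → All.lookup x∉xs z∈xs (sym z≡x))

  module _ {T : V → Set} where

    PathIn-source : ∀ {u v} → PathIn T u v → T u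
    PathIn-source (here tu)     = tu
    PathIn-source (step tu _ _) = tu

    _++ₚ_ : ∀ {u w v} → PathIn T u w → PathIn T w v → PathIn T u v
    here _        ++ₚ q = q
    step tu adj p ++ₚ q = step tu adj (p ++ₚ q)

    PathIn-leaves : ∀ {as : List V} {u v} → PathIn T u v → u ∈ as → v ∉ as →
      ∃ λ a → ∃ λ t → a ∈ as × t ∉ as × T t × Adj a t
    PathIn-leaves (here _) u∈as v∉as = ⊥-elim (v∉as u∈as)
    PathIn-leaves {as} (step {w = w} _ adj p) u∈as v∉as with w ∈? as
    ... | yes w∈as = PathIn-leaves p w∈as v∉as
    ... | no w∉as  = _ , w , u∈as , w∉as , PathIn-source p , adj

  PathIn-map : ∀ {T T' : V → Set} → (∀ {v} → T v → T' v) → ∀ {u v} → PathIn T u v → PathIn T' u v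
  PathIn-map f (here tu)       = here (f tu)
  PathIn-map f (step tu adj p) = step (f tu) adj (PathIn-map f p)

  Region-mono : ∀ {A B : V → Set} → (∀ {v} → A v → B v) → ∀ {w} → Region A w → Region B w
  Region-mono f (inj₁ aw)             = inj₁ (f aw)
  Region-mono f (inj₂ (u , au , adj)) = inj₂ (u , f au , adj)

  module _ {S R : V → Set} (S-connected : ∀ u v → S u → S v → PathIn S u v)
           (S⊆R : ∀ {v} → S v → R v) (R⊆Region : ∀ {v} → R v → Region S v) where

    pathToS : ∀ {v} → R v → ∃ λ s → S s × PathIn R v s
    pathToS rv with R⊆Region rv
    ... | inj₁ sv              = _ , sv , here rv
    ... | inj₂ (u , su , adj) = u , su , step rv (Adj-sym adj) (here (S⊆R su))

    pathFromS : ∀ {v} → R v → ∃ λ s → S s × PathIn R s v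
    pathFromS rv with R⊆Region rv
    ... | inj₁ sv              = _ , sv , here rv
    ... | inj₂ (u , su , adj) = u , su , step (S⊆R su) adj (here rv)

    sandwiched-connected : ∀ {u v} → R u → R v → PathIn R u v
    sandwiched-connected ru rv with pathToS ru | pathFromS rv
    ... | s , ss , p | s' , ss' , q = p ++ₚ (PathIn-map S⊆R (S-connected s s' ss ss') ++ₚ q)

  Covers : List V → (V → Set) → Set
  Covers L A = ∀ {w} → A w → w ∈ L

  Covers-singleton : ∀ t → Covers (t ∷ neighbours t) (Region (_∈ [ t ]))
  Covers-singleton t (inj₁ (here refl))          = here refl
  Covers-singleton t (inj₂ (_ , here refl , adj)) = there (Adj⇒∈neighbours adj)

  extendCover : V → V → List V → List V
  extendCover a t L = without a (neighbours t) ++ L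

  Covers-extendCover : ∀ {a t as L} → a ∈ as → Adj a t → Covers L (Region (_∈ as)) →
    Covers (extendCover a t L) (Region (_∈ t ∷ as))
  Covers-extendCover {a} {t} {as} {L} a∈as adj cover = covers
    where
    N : List V
    N = without a (neighbours t)
    covers : Covers (N ++ L) (Region (_∈ t ∷ as))
    covers (inj₁ (here refl))  = ∈-++⁺ʳ N (cover (inj₂ (a , a∈as , adj)))
    covers (inj₁ (there w∈as)) = ∈-++⁺ʳ N (cover (inj₁ w∈as))
    covers {w} (inj₂ (_ , here refl , adj')) with w ≟V a
    ... | yes refl = ∈-++⁺ʳ N (cover (inj₁ a∈as))
    ... | no w≢a   = ∈-++⁺ˡ (∈-without (Adj⇒∈neighbours adj') w≢a)
    covers (inj₂ (u , there u∈as , adj')) = ∈-++⁺ʳ N (cover (inj₂ (u , u∈as , adj')))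

  -- a is a neighbour of t, so at most three of the four neighbours of t are new.
  length-extendCover : ∀ {a t} {L : List V} {l} → Adj a t → length L ≤ 3 * l + 2 →
    length (extendCover a t L) ≤ 3 * suc l + 2
  length-extendCover {a} {t} {L} {l} adj bound = begin
    length (without a (neighbours t) ++ L)       ≡⟨ length-++ (without a (neighbours t)) ⟩
    length (without a (neighbours t)) + length L ≤⟨ +-mono-≤ length-new bound ⟩
    3 + (3 * l + 2)                              ≡⟨ sym (+-assoc 3 (3 * l) 2) ⟩
    3 + 3 * l + 2                                ≡⟨ cong (_+ 2) (sym (*-suc 3 l)) ⟩
    3 * suc l + 2                                ∎
    where
    open ≤-Reasoning
    length-new : length (without a (neighbours t)) ≤ 3
    length-new = ≤-pred (≤-trans (length-without (Adj⇒∈neighbours (Adj-sym adj))) (length-neighbours t))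

  ListConnected : List V → Set
  ListConnected ts = ∀ {u v} → u ∈ ts → v ∈ ts → PathIn (_∈ ts) u v

  ⊆⊎leavingAdj : ∀ {ts as : List V} {a₀} → ListConnected ts → as ⊆ ts → a₀ ∈ as →
    ts ⊆ as ⊎ ∃ λ a → ∃ λ t → a ∈ as × t ∉ as × t ∈ ts × Adj a t
  ⊆⊎leavingAdj {ts} {as} connected as⊆ts a₀∈as with all? (_∈? as) ts
  ... | yes ts⊆as = inj₁ (All.lookup ts⊆as)
  ... | no ts⊈as  with find (¬All⇒Any¬ (_∈? as) ts ts⊈as)
  ...   | t , t∈ts , t∉as = inj₂ (PathIn-leaves (connected (as⊆ts a₀∈as) t∈ts) a₀∈as t∉as)

  module _ {ts : List V} (connected : ListConnected ts) where

    NeighbourhoodCover : Set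
    NeighbourhoodCover = ∃ λ L → Covers L (Region (_∈ ts)) × length L ≤ 3 * length ts + 2

    -- The fuel d bounds the number of vertices of ts still missing from as.
    grow : ∀ d {as L} → Unique as → as ⊆ ts → ∃ (_∈ as) →
      Covers L (Region (_∈ as)) → length L ≤ 3 * length as + 2 → length ts ≤ length as + d →
      NeighbourhoodCover
    grow d {as} {L} unique as⊆ts (_ , a₀∈as) cover bound fuel with ⊆⊎leavingAdj connected as⊆ts a₀∈as
    ... | inj₁ ts⊆as =
      L , cover ∘ Region-mono ts⊆as , ≤-trans bound (+-monoˡ-≤ 2 (*-monoʳ-≤ 3 (length-mono-⊆ unique as⊆ts)))
    ... | inj₂ (a , t , a∈as , t∉as , t∈ts , adj) = grow-step d fuel
      where
      t∷as⊆ts : t ∷ as ⊆ ts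
      t∷as⊆ts = ∈-∷⁺ʳ t∈ts as⊆ts
      grow-step : ∀ d → length ts ≤ length as + d → NeighbourhoodCover
      grow-step zero fuel =
        ⊥-elim (<⇒≱ (length-mono-⊆ (Unique-∷⁺ t∉as unique) t∷as⊆ts)
                    (subst (length ts ≤_) (+-identityʳ _) fuel))
      grow-step (suc d) fuel =
        grow d (Unique-∷⁺ t∉as unique) t∷as⊆ts (t , here refl)
          (Covers-extendCover a∈as adj cover) (length-extendCover adj bound)
          (subst (length ts ≤_) (+-suc (length as) d) fuel)

    neighbourhoodCover : ∀ {t} → t ∈ ts → NeighbourhoodCover
    neighbourhoodCover {t} t∈ts =
      grow (length ts) (All.[] ∷ []) (∈-∷⁺ʳ t∈ts λ ()) (t , here refl) (Covers-singleton t)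
        (s≤s (length-neighbours t)) (m≤n+m (length ts) 1)

mainTheorem6 : ∀ {m n} (P : Distribution m n) (S : Vertex m n → Set) →
    IsReachComponent P S →
    (k : ℕ) (reach regionList : List (Vertex m n)) →
    Enumerates reach (λ v → Region S v × TwoReachable P v) →
    length reach ≡ k →
    Enumerates regionList (Region S) →
    length regionList ≤ 3 * k + 2
mainTheorem6 P S ((((s₀ , s₀∈S) , S-connected) , S-reachable) , _) k reach regionList
             (_ , reach-enumerates) refl (regionList-unique , regionList-enumerates) =
  let L , covers , bound = neighbourhoodCover reach-connected (S⊆reach s₀∈S)
  in ≤-trans (length-mono-⊆ regionList-unique (covers ∘ Region-mono S⊆reach ∘ to (regionList-enumerates _)))
             bound
  where
  open Equivalence
  S⊆reach : ∀ {v} → S v → v ∈ reach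
  S⊆reach {v} sv = from (reach-enumerates v) (inj₁ sv , S-reachable v sv)
  reach-connected : ListConnected reach
  reach-connected u∈reach v∈reach =
    PathIn-map (from (reach-enumerates _))
      (sandwiched-connected S-connected (λ {v} sv → inj₁ sv , S-reachable v sv) proj₁
        (to (reach-enumerates _) u∈reach) (to (reach-enumerates _) v∈reach))
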